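{- Let $k\ge 4$ and let $M_k$ be the graph with vertex set $\{w_1,\dots,w_{k+4},x,v_1,\dots,v_k\}$ whose edges are: the cycle edges $w_iw_{i+1}$ for $i\in[k+3]$ and $w_{k+4}w_1$; the edges $xw_i$ for all $i\in[k+4]$ (so these form the wheel $W_{k+4}$ with center $x$); all edges $v_iv_j$ for $1\le i<j\le k$ (a complete graph $K_k$); and the matching edges $v_iw_i$ for $i\in[k]$. Then $\mathrm{gp}_{\rm d}(M_k)=k+2$ and $\mathrm{gp}_{\rm d}(M_k-x)=0$.
   Context: All graphs are finite and simple. For a graph $G$ and $Z\subseteq V(G)$, two vertices $p,q\in V(G)$ are $Z$-positionable if no shortest $p,q$-path in $G$ has an internal vertex in $Z$. $Z$ is a dual general position set if every two vertices of $Z$ are $Z$-positionable and every two vertices of $V(G)\setminus Z$ are $Z$-positionable (the empty set qualifies). $\mathrm{gp}_{\rm d}(G)$ is the maximum cardinality of a dual general position set of $G$. $G-x$ is the graph obtained by deleting $x$ and its incident edges; $[m]=\{1,\dots,m\}$. -}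

module Defs where

open import Data.Nat using (ℕ; zero; suc; _+_; _≤_; _<_)
open import Data.Fin using (Fin; zero; suc; toℕ; splitAt; _↑ˡ_; punchIn)
open import Data.Fin.Subset using (Subset; _∈_; _∉_; ∣_∣)
open import Data.Sum using (_⊎_; inj₁; inj₂)
open import Data.Product using (Σ; _×_; _,_)
open import Data.List using (List; []; _∷_)
open import Data.List.Relation.Unary.All using (All)
open import Relation.Binary.PropositionalEquality using (_≡_)

record Graph (n : ℕ) : Set₁ where
  field
    Adj : Fin n → Fin n → Set
open Graph public

data Walk {n : ℕ} (G : Graph n) : Fin n → Fin n → ℕ → Set where
  nil  : ∀ {u} → Walk G u u 0
  cons : ∀ {u v w l} → Adj G u v → Walk G v w l → Walk G u w (suc l)

interior : ∀ {n} {G : Graph n} {u w l} → Walk G u w l → List (Fin n)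
interior nil = []
interior (cons a nil) = []
interior (cons {v = v} a (cons b r)) = v ∷ interior (cons b r)

-- A shortest u,w-walk: no u,w-walk is shorter. (Shortest walks are paths,
-- so these are exactly the shortest u,w-paths.)
Shortest : ∀ {n} {G : Graph n} {u w l} → Walk G u w l → Set
Shortest {G = G} {u} {w} {l} _ = ∀ l' → Walk G u w l' → l ≤ l'

Positionable : ∀ {n} (G : Graph n) (Z : Subset n) (p q : Fin n) → Set
Positionable G Z p q =
  ∀ l (P : Walk G p q l) → Shortest P → All (λ y → y ∉ Z) (interior P)

DualGP : ∀ {n} (G : Graph n) (Z : Subset n) → Set
DualGP G Z =
  (∀ p q → p ∈ Z → q ∈ Z → Positionable G Z p q) ×
  (∀ p q → p ∉ Z → q ∉ Z → Positionable G Z p q)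

GpdIs : ∀ {n} (G : Graph n) (m : ℕ) → Set
GpdIs {n} G m =
  Σ (Subset n) (λ Z → DualGP G Z × ∣ Z ∣ ≡ m) ×
  (∀ (Z : Subset n) → DualGP G Z → ∣ Z ∣ ≤ m)

_-ᵥ_ : ∀ {n} → Graph (suc n) → Fin (suc n) → Graph n
Adj (G -ᵥ x) a b = Adj G (punchIn x a) (punchIn x b)

-- The graph M_k.
-- Vertices: w i (i : Fin (k+4)) stands for w_{i+1}; x; v j (j : Fin k) stands for v_{j+1}.
data MVtx (k : ℕ) : Set where
  w : Fin (k + 4) → MVtx k
  x : MVtx k
  v : Fin k → MVtx k

data MEdge (k : ℕ) : MVtx k → MVtx k → Set where
  cyc   : (i j : Fin (k + 4)) → toℕ j ≡ suc (toℕ i) → MEdge k (w i) (w j)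
  close : (i j : Fin (k + 4)) → toℕ i ≡ k + 3 → toℕ j ≡ 0 → MEdge k (w i) (w j)
  spoke : (i : Fin (k + 4)) → MEdge k x (w i)
  clq   : (i j : Fin k) → toℕ i < toℕ j → MEdge k (v i) (v j)
  match : (i : Fin k) → MEdge k (v i) (w (i ↑ˡ 4))

toMVtx : ∀ k → Fin (suc ((k + 4) + k)) → MVtx k
toMVtx k zero = x
toMVtx k (suc i) with splitAt (k + 4) i
... | inj₁ a = w a
... | inj₂ b = v b

M : (k : ℕ) → Graph (suc ((k + 4) + k))
Adj (M k) a b = MEdge k (toMVtx k a) (toMVtx k b) ⊎ MEdge k (toMVtx k b) (toMVtx k a)

xM : (k : ℕ) → Fin (suc ((k + 4) + k))
xM k = zero

-- A set Z is a dual general position set exactly when, colouring every vertex by whether it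
-- lies in Z, no geodesic between two vertices of equal colour has an interior vertex in Z.
-- Two consequences drive the upper bounds: the middle vertex of a geodesic of length 2 in Z
-- forces different colours on its ends, and so (by pigeonhole) the centre of an induced claw
-- is never in Z.
--
-- In M_k, x is the centre of the claw w_1, w_3, w_{k+2}. If some w_i (i ≤ k) is in Z, the
-- geodesics x w_i v_i and w_i v_i v_j force v_i ∈ Z and v_j ∉ Z for j ≠ i, so at most
-- w_i, v_i and w_{k+1}, …, w_{k+4} are in Z, and 6 ≤ k + 2. Otherwise the geodesics of length 2
-- along w_k w_{k+1} … w_{k+4} w_1 allow at most two of w_{k+1}, …, w_{k+4} in Z. The bound is
-- attained by {v_1, …, v_k, w_{k+2}, w_{k+3}}: every vertex other than the v_j is within
-- distance 1 of x, so M_k has diameter 3 and only geodesics of length 2 and 3 need checking.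
--
-- In M_k − x every w_i (i ≤ k) is the centre of the claw w_{i−1}, w_{i+1}, v_i. Then v_i ∈ Z
-- would force v_1 ∈ Z, which the geodesic w_1 v_1 v_4 w_4 forbids; and the geodesics of
-- length 2 and 3 along w_k w_{k+1} … w_{k+4} w_1 leave none of w_{k+1}, …, w_{k+4} in Z.

module Submission where

open import Defs
open import Data.Bool using (Bool; true; false; T; _∨_)
open import Data.Bool.Properties using (¬-not; not-¬; not-injective; T-∨; ∨-comm) renaming (_≟_ to _≟ᵇ_)
open import Data.Empty using (⊥; ⊥-elim)
open import Data.Fin using (Fin; zero; suc; toℕ; fromℕ; fromℕ<; inject₁; splitAt; _↑ˡ_; _↑ʳ_)
  renaming (_≟_ to _≟ᶠ_)
open import Data.Fin.Patterns using (0F; 1F; 2F; 3F)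
open import Data.Fin.Properties using (toℕ-↑ˡ; toℕ-↑ʳ; toℕ<n; toℕ-injective; toℕ-fromℕ; toℕ-fromℕ<;
  toℕ-inject₁; splitAt-↑ˡ; splitAt-↑ʳ; splitAt⁻¹-↑ˡ; splitAt⁻¹-↑ʳ; <-cmp; all?; any?)
open import Data.Fin.Subset using (Subset; _∈_; _∉_; _⊆_; ∣_∣; ⁅_⁆) renaming (⊥ to ∅)
open import Data.Fin.Subset.Properties using (∉⊥; ∣⊥∣≡0; ∣p∣≤n; p⊆q⇒∣p∣≤∣q∣; ∣⁅x⁆∣≡1; x∈⁅x⁆)
open import Data.List using (List; []; _∷_; map)
open import Data.List.Relation.Unary.All using (All; []; _∷_; universal) renaming (map to All-map)
open import Data.List.Relation.Unary.All.Properties using (map⁻)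
open import Data.Nat using (ℕ; zero; suc; _+_; _≤_; _<_; z≤n; s≤s; _≡ᵇ_; _≟_)
open import Data.Nat.Properties using (≤-refl; ≤-reflexive; ≤-trans; +-mono-≤; +-comm; +-suc;
  +-identityʳ; +-cancelˡ-≡; n≤1+n; m≤n+m; 1+n≰n; m+1+n≰m; m+n≮m; 1+n≢0; 1+n≢n; m≢1+n+m;
  <⇒≢; ≤∧≢⇒<; ≡ᵇ⇒≡; ≡⇒≡ᵇ; m≤n⇒∃[o]m+o≡n)
open import Data.Product using (∃-syntax; _×_; _,_)
open import Data.Sum using (_⊎_; inj₁; inj₂; [_,_]′) renaming (map to ⊎-map)
open import Data.Unit using (⊤; tt)
open import Data.Vec using ([]; _∷_; lookup; tabulate)
open import Data.Vec.Properties using (lookup⇒[]=; []=⇒lookup; lookup∘tabulate; tabulate∘lookup;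
  tabulate-cong)
open import Function using (_∘_; id)
open import Function.Bundles using (Equivalence)
open import Relation.Binary using (tri<; tri≈; tri>)
open import Relation.Binary.Definitions using (Symmetric)
open import Relation.Binary.PropositionalEquality using (_≡_; _≢_; _≗_; ≢-sym; refl; sym; trans;
  cong; cong₂; subst; subst₂; module ≡-Reasoning)
open import Relation.Nullary using (¬_; yes; no)
open import Relation.Nullary.Decidable using (toWitness; T?; _→-dec_)

module _ {V : Set} (E : V → V → Set) where

  data Walkᵣ : V → V → ℕ → Set where
    nil  : ∀ {A} → Walkᵣ A A 0
    cons : ∀ {A B C l} → E A B → Walkᵣ B C l → Walkᵣ A C (suc l)

  interiorᵣ : ∀ {A C l} → Walkᵣ A C l → List V
  interiorᵣ nil                          = []
  interiorᵣ (cons _ nil)                 = []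
  interiorᵣ (cons {B = B} _ (cons e P)) = B ∷ interiorᵣ (cons e P)

  Far : ℕ → V → V → Set
  Far d A B = ∀ {l} → Walkᵣ A B l → d ≤ l

  Near : ℕ → V → V → Set
  Near d A B = ∃[ l ] l ≤ d × Walkᵣ A B l

  Geodesic : ∀ {A B l} → Walkᵣ A B l → Set
  Geodesic {A} {B} {l} _ = Far l A B

  DualGPᵣ : (V → Bool) → Set
  DualGPᵣ z = ∀ {A B l} → z A ≡ z B → (P : Walkᵣ A B l) → Geodesic P →
              All (λ C → z C ≡ false) (interiorᵣ P)

module _ {V : Set} {E : V → V → Set} where

  far₂ : ∀ {A B} → A ≢ B → ¬ E A B → Far E 2 A B
  far₂ A≢B _   nil                 = ⊥-elim (A≢B refl)
  far₂ _   ¬AB (cons e nil)        = ⊥-elim (¬AB e)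
  far₂ _   _   (cons _ (cons _ _)) = s≤s (s≤s z≤n)

  far₃ : ∀ {A B} → A ≢ B → ¬ E A B → (∀ {C} → E A C → ¬ E C B) → Far E 3 A B
  far₃ A≢B _   _    nil                           = ⊥-elim (A≢B refl)
  far₃ _   ¬AB _    (cons e nil)                  = ⊥-elim (¬AB e)
  far₃ _   _   ¬ACB (cons e (cons e' nil))        = ⊥-elim (¬ACB e e')
  far₃ _   _   _    (cons _ (cons _ (cons _ _))) = s≤s (s≤s (s≤s z≤n))

  near-far⇒≤ : ∀ {d m A B} → Near E d A B → Far E m A B → m ≤ d
  near-far⇒≤ (_ , l≤d , P) far = ≤-trans (far P) l≤d

  near-≡ : ∀ {d A B} → A ≡ B → Near E d A B
  near-≡ refl = 0 , z≤n , nil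

  near-edge : ∀ {A B} → E A B → Near E 1 A B
  near-edge e = 1 , ≤-refl , cons e nil

  near-weaken : ∀ {d d' A B} → d ≤ d' → Near E d A B → Near E d' A B
  near-weaken d≤d' (l , l≤d , P) = l , ≤-trans l≤d d≤d' , P

  _++ᵣ_ : ∀ {A B C l m} → Walkᵣ E A B l → Walkᵣ E B C m → Walkᵣ E A C (l + m)
  nil      ++ᵣ Q = Q
  cons e P ++ᵣ Q = cons e (P ++ᵣ Q)

  near-trans : ∀ {d d' A B C} → Near E d A B → Near E d' B C → Near E (d + d') A C
  near-trans (l , l≤d , P) (m , m≤d' , Q) = l + m , +-mono-≤ l≤d m≤d' , P ++ᵣ Q

  module _ (E-sym : Symmetric E) where

    snoc : ∀ {A B C l} → Walkᵣ E A B l → E B C → Walkᵣ E A C (suc l)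
    snoc nil         e = cons e nil
    snoc (cons e' P) e = cons e' (snoc P e)

    reverse : ∀ {A B l} → Walkᵣ E A B l → Walkᵣ E B A l
    reverse nil        = nil
    reverse (cons e P) = snoc (reverse P) (E-sym e)

    near-sym : ∀ {d A B} → Near E d A B → Near E d B A
    near-sym (l , l≤d , P) = l , l≤d , reverse P

-- Constraints on the statuses along geodesics

-- What a dual general position set demands of the statuses on a geodesic a, y, b
-- (resp. a, y, y', b).
Split₂ : Bool → Bool → Bool → Set
Split₂ a y b = y ≡ true → a ≢ b

Split₃ : Bool → Bool → Bool → Bool → Set
Split₃ a y y' b = y ≡ true ⊎ y' ≡ true → a ≢ b

split₂-pigeonhole : ∀ {a b c y} → Split₂ a y b → Split₂ a y c → Split₂ b y c → y ≡ false
split₂-pigeonhole {y = false} _ _ _ = refl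
split₂-pigeonhole {y = true} ab ac bc =
  ⊥-elim (bc refl (not-injective (trans (sym (¬-not (ab refl))) (¬-not (ac refl)))))

split₂-forces : ∀ {a y b} → Split₂ a y b → y ≡ true → a ≡ false → b ≡ true
split₂-forces split y∈ refl = ¬-not (≢-sym (split y∈))

-- The statuses s₁ … s₄ of the inner vertices of a path s₀ … s₅ whose ends are not in the set
-- and whose subpaths of length 2 are geodesics.
data Inner₄ : Bool → Bool → Bool → Bool → Set where
  empty : Inner₄ false false false false
  pair₁ : Inner₄ true  true  false false
  pair₂ : Inner₄ false true  true  false
  pair₃ : Inner₄ false false true  true

inner₄ : ∀ {s₀ s₅} s₁ s₂ s₃ s₄ → s₀ ≡ false → s₅ ≡ false →
         Split₂ s₀ s₁ s₂ → Split₂ s₁ s₂ s₃ → Split₂ s₂ s₃ s₄ → Split₂ s₃ s₄ s₅ →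
         Inner₄ s₁ s₂ s₃ s₄
inner₄ false false false false _    _    _  _  _  _  = empty
inner₄ true  true  false false _    _    _  _  _  _  = pair₁
inner₄ false true  true  false _    _    _  _  _  _  = pair₂
inner₄ false false true  true  _    _    _  _  _  _  = pair₃
inner₄ true  false _     _     refl _    c₁ _  _  _  = ⊥-elim (c₁ refl refl)
inner₄ false true  false _     _    _    _  c₂ _  _  = ⊥-elim (c₂ refl refl)
inner₄ true  true  true  _     _    _    _  c₂ _  _  = ⊥-elim (c₂ refl refl)
inner₄ _     false true  false _    _    _  _  c₃ _  = ⊥-elim (c₃ refl refl)
inner₄ _     true  true  true  _    _    _  _  c₃ _  = ⊥-elim (c₃ refl refl)
inner₄ _     _     false true  _    refl _  _  _  c₄ = ⊥-elim (c₄ refl refl)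

∣Inner₄∣≤2 : ∀ {s₁ s₂ s₃ s₄} → Inner₄ s₁ s₂ s₃ s₄ → ∣ s₁ ∷ s₂ ∷ s₃ ∷ s₄ ∷ [] ∣ ≤ 2
∣Inner₄∣≤2 empty = z≤n
∣Inner₄∣≤2 pair₁ = ≤-refl
∣Inner₄∣≤2 pair₂ = ≤-refl
∣Inner₄∣≤2 pair₃ = ≤-refl

Inner₄-empty : ∀ {s₀ s₁ s₂ s₃ s₄ s₅} → s₀ ≡ false → s₅ ≡ false → Inner₄ s₁ s₂ s₃ s₄ →
               Split₃ s₀ s₁ s₂ s₃ → Split₃ s₁ s₂ s₃ s₄ → Split₃ s₂ s₃ s₄ s₅ →
               s₁ ≡ false × s₂ ≡ false × s₃ ≡ false × s₄ ≡ false
Inner₄-empty _    _    empty _  _  _  = refl , refl , refl , refl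
Inner₄-empty refl _    pair₁ d₁ _  _  = ⊥-elim (d₁ (inj₁ refl) refl)
Inner₄-empty _    _    pair₂ _  d₂ _  = ⊥-elim (d₂ (inj₁ refl) refl)
Inner₄-empty _    refl pair₃ _  _  d₃ = ⊥-elim (d₃ (inj₁ refl) refl)

record InducedClaw {V : Set} (E : V → V → Set) (Y : V) : Set where
  field
    {A B C} : V
    Y—A : E Y A
    Y—B : E Y B
    Y—C : E Y C
    A⋯B : Far E 2 A B
    A⋯C : Far E 2 A C
    B⋯C : Far E 2 B C

module _ {V : Set} {E : V → V → Set} {z : V → Bool} (dgp : DualGPᵣ E z) where

  geodesic₂-split : ∀ A Y B → Far E 2 A B → E A Y → E Y B → Split₂ (z A) (z Y) (z B)
  geodesic₂-split _ _ _ far e e' Y∈ same with dgp same (cons e (cons e' nil)) far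
  ... | Y∉ ∷ [] = not-¬ Y∈ Y∉

  geodesic₃-split : ∀ A Y Y' B → Far E 3 A B → E A Y → E Y Y' → E Y' B →
                    Split₃ (z A) (z Y) (z Y') (z B)
  geodesic₃-split _ _ _ _ far e e' e'' one∈ same
    with dgp same (cons e (cons e' (cons e'' nil))) far | one∈
  ... | Y∉ ∷ _        | inj₁ Y∈  = not-¬ Y∈ Y∉
  ... | _ ∷ Y'∉ ∷ [] | inj₂ Y'∈ = not-¬ Y'∈ Y'∉

  induced-claw-centre : Symmetric E → ∀ {Y} → InducedClaw E Y → z Y ≡ false
  induced-claw-centre E-sym claw = split₂-pigeonhole
    (geodesic₂-split A _ B A⋯B (E-sym Y—A) Y—B)
    (geodesic₂-split A _ C A⋯C (E-sym Y—A) Y—C)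
    (geodesic₂-split B _ C B⋯C (E-sym Y—B) Y—C)
    where open InducedClaw claw

module _ {V : Set} {E : V → V → Set} where

  dualGPᵣ-cong : ∀ {z z'} → z ≗ z' → DualGPᵣ E z → DualGPᵣ E z'
  dualGPᵣ-cong {z} {z'} z≗z' dgp {A} {B} same P geo =
    All-map (trans (sym (z≗z' _))) (dgp (trans (z≗z' A) (trans same (sym (z≗z' B)))) P geo)

  dualGPᵣ-of-diameter≤3 : Symmetric E → ∀ {z} →
    (∀ A B → Near E 3 A B) →
    (∀ {A Y B} → E A Y → E Y B → z Y ≡ true → z A ≡ z B → Near E 1 A B) →
    (∀ {A Y Y' B} → E A Y → E Y Y' → E Y' B → z Y ≡ true → z A ≡ z B → Near E 2 A B) →
    DualGPᵣ E z
  dualGPᵣ-of-diameter≤3 _ _ _ _ _ nil _ = []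
  dualGPᵣ-of-diameter≤3 _ _ _ _ _ (cons _ nil) _ = []
  dualGPᵣ-of-diameter≤3 _ _ two _ same (cons e (cons e' nil)) geo =
    ¬-not (λ Y∈ → 1+n≰n (near-far⇒≤ (two e e' Y∈ same) geo)) ∷ []
  dualGPᵣ-of-diameter≤3 E-sym _ _ three same (cons e (cons e' (cons e'' nil))) geo =
    ¬-not (λ Y∈ → 1+n≰n (near-far⇒≤ (three e e' e'' Y∈ same) geo)) ∷
    ¬-not (λ Y'∈ → 1+n≰n (near-far⇒≤ (near-sym E-sym
      (three (E-sym e'') (E-sym e') (E-sym e) Y'∈ (sym same))) geo)) ∷ []
  dualGPᵣ-of-diameter≤3 _ diam _ _ {A} {B} _ (cons _ (cons _ (cons _ (cons _ _)))) geo =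
    ⊥-elim (m+1+n≰m 3 (near-far⇒≤ (diam A B) geo))

∉⇒lookup≡false : ∀ {n} {Z : Subset n} {p} → p ∉ Z → lookup Z p ≡ false
∉⇒lookup≡false {Z = Z} {p} p∉Z = ¬-not (λ p∈Z → p∉Z (lookup⇒[]= p Z p∈Z))

lookup≡false⇒∉ : ∀ {n} {Z : Subset n} {p} → lookup Z p ≡ false → p ∉ Z
lookup≡false⇒∉ Zp≡false p∈Z = not-¬ ([]=⇒lookup p∈Z) Zp≡false

dualGP-∅ : ∀ {n} {G : Graph n} → DualGP G ∅
dualGP-∅ = (λ _ _ p∈∅ _ → ⊥-elim (∉⊥ p∈∅)) , (λ _ _ _ _ _ P _ → universal (λ _ → ∉⊥) (interior P))

sameStatus⇒positionable : ∀ {n} {G : Graph n} {Z} → DualGP G Z →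
                          ∀ {p q} → lookup Z p ≡ lookup Z q → Positionable G Z p q
sameStatus⇒positionable {Z = Z} (inside , outside) {p} {q} same
  with lookup Z p in p-status | lookup Z q in q-status | same
... | true  | true  | _ = inside p q (lookup⇒[]= p Z p-status) (lookup⇒[]= q Z q-status)
... | false | false | _ = outside p q (lookup≡false⇒∉ p-status) (lookup≡false⇒∉ q-status)

∣tabulate∣-splitAt : ∀ m {n} (f : Fin (m + n) → Bool) →
                     ∣ tabulate f ∣ ≡ ∣ tabulate (f ∘ (_↑ˡ n)) ∣ + ∣ tabulate (f ∘ (m ↑ʳ_)) ∣
∣tabulate∣-splitAt zero    f = refl
∣tabulate∣-splitAt (suc m) f with f zero
... | true  = cong suc (∣tabulate∣-splitAt m (f ∘ suc))
... | false = ∣tabulate∣-splitAt m (f ∘ suc)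

∣tabulate∣≡0 : ∀ {n} {f : Fin n → Bool} → (∀ i → f i ≡ false) → ∣ tabulate f ∣ ≡ 0
∣tabulate∣≡0 {zero}  _ = refl
∣tabulate∣≡0 {suc n} all-false rewrite all-false zero = ∣tabulate∣≡0 (all-false ∘ suc)

∣tabulate∣≡n : ∀ {n} {f : Fin n → Bool} → (∀ i → f i ≡ true) → ∣ tabulate f ∣ ≡ n
∣tabulate∣≡n {zero}  _ = refl
∣tabulate∣≡n {suc n} all-true rewrite all-true zero = cong suc (∣tabulate∣≡n (all-true ∘ suc))

∣tabulate∣≤1 : ∀ {n} {f : Fin n → Bool} a → (∀ i → f i ≡ true → i ≡ a) → ∣ tabulate f ∣ ≤ 1
∣tabulate∣≤1 {f = f} a only-a = ≤-trans (p⊆q⇒∣p∣≤∣q∣ ⊆⁅a⁆) (≤-reflexive (∣⁅x⁆∣≡1 a))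
  where
  ⊆⁅a⁆ : tabulate f ⊆ ⁅ a ⁆
  ⊆⁅a⁆ {i} i∈ = subst (_∈ ⁅ a ⁆)
    (sym (only-a i (trans (sym (lookup∘tabulate f i)) ([]=⇒lookup i∈)))) (x∈⁅x⁆ a)

record GraphIso {n : ℕ} (G : Graph n) {V : Set} (E : V → V → Set) : Set where
  field
    decode        : Fin n → V
    encode        : V → Fin n
    decode∘encode : ∀ A → decode (encode A) ≡ A
    encode∘decode : ∀ p → encode (decode p) ≡ p
    adj⇒rel       : ∀ {p q} → Adj G p q → E (decode p) (decode q)
    rel⇒adj       : ∀ {A B} → E A B → Adj G (encode A) (encode B)

module _ {n} {G : Graph n} {V : Set} {E : V → V → Set} (iso : GraphIso G E) where
  open GraphIso iso

  status : Subset n → V → Bool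
  status Z A = lookup Z (encode A)

  encodeWalk : ∀ {A B l} → Walkᵣ E A B l → Walk G (encode A) (encode B) l
  encodeWalk nil        = nil
  encodeWalk (cons e P) = cons (rel⇒adj e) (encodeWalk P)

  decodeWalk : ∀ {p q l} → Walk G p q l → Walkᵣ E (decode p) (decode q) l
  decodeWalk nil        = nil
  decodeWalk (cons a P) = cons (adj⇒rel a) (decodeWalk P)

  interior-encodeWalk : ∀ {A B l} (P : Walkᵣ E A B l) →
                        interior (encodeWalk P) ≡ map encode (interiorᵣ E P)
  interior-encodeWalk nil                 = refl
  interior-encodeWalk (cons _ nil)        = refl
  interior-encodeWalk (cons _ (cons e P)) = cong (_ ∷_) (interior-encodeWalk (cons e P))

  interior-decodeWalk : ∀ {p q l} (P : Walk G p q l) →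
                        interiorᵣ E (decodeWalk P) ≡ map decode (interior P)
  interior-decodeWalk nil                 = refl
  interior-decodeWalk (cons _ nil)        = refl
  interior-decodeWalk (cons _ (cons a P)) = cong (_ ∷_) (interior-decodeWalk (cons a P))

  encodeWalk-shortest : ∀ {A B l} (P : Walkᵣ E A B l) → Geodesic E P → Shortest (encodeWalk P)
  encodeWalk-shortest P geo l' Q =
    geo (subst₂ (λ A B → Walkᵣ E A B l') (decode∘encode _) (decode∘encode _) (decodeWalk Q))

  decodeWalk-geodesic : ∀ {p q l} (P : Walk G p q l) → Shortest P → Geodesic E (decodeWalk P)
  decodeWalk-geodesic P shortest {l'} Q =
    shortest l' (subst₂ (λ p q → Walk G p q l') (encode∘decode _) (encode∘decode _) (encodeWalk Q))

  dualGP⇒dualGPᵣ : ∀ {Z} → DualGP G Z → DualGPᵣ E (status Z)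
  dualGP⇒dualGPᵣ {Z} dgp same P geo = All-map ∉⇒lookup≡false (map⁻ interior∉)
    where
    interior∉ : All (_∉ Z) (map encode (interiorᵣ E P))
    interior∉ = subst (All (_∉ Z)) (interior-encodeWalk P)
      (sameStatus⇒positionable dgp same _ (encodeWalk P) (encodeWalk-shortest P geo))

  dualGPᵣ⇒dualGP : ∀ {Z} → DualGPᵣ E (status Z) → DualGP G Z
  dualGPᵣ⇒dualGP {Z} dgp =
    (λ p q p∈ q∈ → positionable (trans ([]=⇒lookup p∈) (sym ([]=⇒lookup q∈)))) ,
    (λ p q p∉ q∉ → positionable (trans (∉⇒lookup≡false p∉) (sym (∉⇒lookup≡false q∉))))
    where
    status-decode : ∀ p → status Z (decode p) ≡ lookup Z p
    status-decode p = cong (lookup Z) (encode∘decode p)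

    positionable : ∀ {p q} → lookup Z p ≡ lookup Z q → Positionable G Z p q
    positionable {p} {q} same l P shortest =
      All-map (λ {y} y∉ → lookup≡false⇒∉ (trans (sym (status-decode y)) y∉))
        (map⁻ (subst (All _) (interior-decodeWalk P)
          (dgp (trans (status-decode p) (trans same (sym (status-decode q))))
               (decodeWalk P) (decodeWalk-geodesic P shortest))))

  status-tabulate : ∀ (f : V → Bool) A → status (tabulate (f ∘ decode)) A ≡ f A
  status-tabulate f A = trans (lookup∘tabulate (f ∘ decode) (encode A)) (cong f (decode∘encode A))

  status-false⇒∣∣≡0 : ∀ {Z} → (∀ A → status Z A ≡ false) → ∣ Z ∣ ≡ 0
  status-false⇒∣∣≡0 {Z} all-false = trans (cong ∣_∣ (sym (tabulate∘lookup Z)))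
    (∣tabulate∣≡0 (λ p → subst (λ r → lookup Z r ≡ false) (encode∘decode p) (all-false (decode p))))

-- The graphs M_k and M_k − x

-- A boolean test, so that the adjacency of two concrete indices computes to ⊤ or ⊥.
adjacentᵇ : ℕ → ℕ → Bool
adjacentᵇ m n = (suc m ≡ᵇ n) ∨ (suc n ≡ᵇ m)

adjacentᵇ-intro : ∀ {m n} → suc m ≡ n → T (adjacentᵇ m n)
adjacentᵇ-intro {m} {n} eq = Equivalence.from T-∨ (inj₁ (≡⇒≡ᵇ (suc m) n eq))

adjacentᵇ-elim : ∀ {m n} → T (adjacentᵇ m n) → suc m ≡ n ⊎ suc n ≡ m
adjacentᵇ-elim {m} {n} adj = ⊎-map (≡ᵇ⇒≡ (suc m) n) (≡ᵇ⇒≡ (suc n) m) (Equivalence.to T-∨ adj)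

adjacentᵇ-sym : ∀ {m n} → T (adjacentᵇ m n) → T (adjacentᵇ n m)
adjacentᵇ-sym {m} {n} = subst T (∨-comm (suc m ≡ᵇ n) (suc n ≡ᵇ m))

module Mₖ (k₀ : ℕ) where

  k : ℕ
  k = 4 + k₀

  -- L i = w_{i+1} is matched with V i = v_{i+1} (i < k), H j = w_{k+j+1} (j < 4), and X = x.
  data Vertex⁻ : Set where
    L : Fin k → Vertex⁻
    H : Fin 4 → Vertex⁻
    V : Fin k → Vertex⁻

  data Vertex : Set where
    X   : Vertex
    ⟨_⟩ : Vertex⁻ → Vertex

  -- the edges w_k w_{k+1} and w_{k+4} w_1
  LH : Fin k → Fin 4 → Set
  LH a 0F = suc (toℕ a) ≡ k
  LH a 3F = toℕ a ≡ 0
  LH _ _  = ⊥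

  _—_ : Vertex⁻ → Vertex⁻ → Set
  L a — L b = T (adjacentᵇ (toℕ a) (toℕ b))
  H i — H j = T (adjacentᵇ (toℕ i) (toℕ j))
  L a — H j = LH a j
  H j — L a = LH a j
  V i — V j = i ≢ j
  V i — L j = i ≡ j
  L j — V i = i ≡ j
  V _ — H _ = ⊥
  H _ — V _ = ⊥

  OnRim : Vertex⁻ → Set
  OnRim (V _) = ⊥
  OnRim _     = ⊤

  _∼_ : Vertex → Vertex → Set
  X     ∼ X     = ⊥
  X     ∼ ⟨ b ⟩ = OnRim b
  ⟨ a ⟩ ∼ X     = OnRim a
  ⟨ a ⟩ ∼ ⟨ b ⟩ = a — b

  —-sym : Symmetric _—_
  —-sym {L a} {L b} = adjacentᵇ-sym {toℕ a} {toℕ b}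
  —-sym {H i} {H j} = adjacentᵇ-sym {toℕ i} {toℕ j}
  —-sym {L _} {H _} = id
  —-sym {H _} {L _} = id
  —-sym {V _} {V _} = ≢-sym
  —-sym {V _} {L _} = id
  —-sym {L _} {V _} = id

  ∼-sym : Symmetric _∼_
  ∼-sym {X}     {⟨ _ ⟩} = id
  ∼-sym {⟨ _ ⟩} {X}     = id
  ∼-sym {⟨ a ⟩} {⟨ b ⟩} = —-sym {a} {b}

  rim : Fin (k + 4) → Vertex⁻
  rim c = [ L , H ]′ (splitAt k c)

  vertex⁻ : Fin ((k + 4) + k) → Vertex⁻
  vertex⁻ p = [ rim , V ]′ (splitAt (k + 4) p)

  index⁻ : Vertex⁻ → Fin ((k + 4) + k)
  index⁻ (L a) = (a ↑ˡ 4) ↑ˡ k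
  index⁻ (H j) = (k ↑ʳ j) ↑ˡ k
  index⁻ (V i) = (k + 4) ↑ʳ i

  vertex⁻∘index⁻ : ∀ a → vertex⁻ (index⁻ a) ≡ a
  vertex⁻∘index⁻ (L a) rewrite splitAt-↑ˡ (k + 4) (a ↑ˡ 4) k | splitAt-↑ˡ k a 4 = refl
  vertex⁻∘index⁻ (H j) rewrite splitAt-↑ˡ (k + 4) (k ↑ʳ j) k | splitAt-↑ʳ k 4 j = refl
  vertex⁻∘index⁻ (V i) rewrite splitAt-↑ʳ (k + 4) k i = refl

  index⁻∘vertex⁻ : ∀ p → index⁻ (vertex⁻ p) ≡ p
  index⁻∘vertex⁻ p with splitAt (k + 4) p in eq
  ... | inj₂ i = splitAt⁻¹-↑ʳ eq
  ... | inj₁ c with splitAt k c in eq'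
  ...   | inj₁ a = trans (cong (_↑ˡ k) (splitAt⁻¹-↑ˡ eq')) (splitAt⁻¹-↑ˡ eq)
  ...   | inj₂ j = trans (cong (_↑ˡ k) (splitAt⁻¹-↑ʳ eq')) (splitAt⁻¹-↑ˡ eq)

  vertex : Fin (suc ((k + 4) + k)) → Vertex
  vertex zero    = X
  vertex (suc p) = ⟨ vertex⁻ p ⟩

  index : Vertex → Fin (suc ((k + 4) + k))
  index X     = zero
  index ⟨ a ⟩ = suc (index⁻ a)

  vertex∘index : ∀ A → vertex (index A) ≡ A
  vertex∘index X     = refl
  vertex∘index ⟨ a ⟩ = cong ⟨_⟩ (vertex⁻∘index⁻ a)

  index∘vertex : ∀ p → index (vertex p) ≡ p
  index∘vertex zero    = refl
  index∘vertex (suc p) = cong suc (index⁻∘vertex⁻ p)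

  data RimView : Fin (k + 4) → Set where
    low  : (a : Fin k) → RimView (a ↑ˡ 4)
    high : (j : Fin 4) → RimView (k ↑ʳ j)

  rimView : ∀ c → RimView c
  rimView c with splitAt k c in eq
  ... | inj₁ a = subst RimView (splitAt⁻¹-↑ˡ eq) (low a)
  ... | inj₂ j = subst RimView (splitAt⁻¹-↑ʳ eq) (high j)

  position : ∀ {c} → RimView c → ℕ
  position (low a)  = toℕ a
  position (high j) = k + toℕ j

  toℕ-position : ∀ {c} (v : RimView c) → toℕ c ≡ position v
  toℕ-position (low a)  = toℕ-↑ˡ a 4
  toℕ-position (high j) = toℕ-↑ʳ k j

  rimOf : ∀ {c} → RimView c → Vertex⁻
  rimOf (low a)  = L a
  rimOf (high j) = H j

  rim-rimOf : ∀ {c} (v : RimView c) → rim c ≡ rimOf v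
  rim-rimOf (low a)  = cong [ L , H ]′ (splitAt-↑ˡ k a 4)
  rim-rimOf (high j) = cong [ L , H ]′ (splitAt-↑ʳ k 4 j)

  onRim-rimOf : ∀ {c} (v : RimView c) → OnRim (rimOf v)
  onRim-rimOf (low _)  = tt
  onRim-rimOf (high _) = tt

  rimOf-succ : ∀ {c d} (u : RimView c) (v : RimView d) → position v ≡ suc (position u) →
               rimOf u — rimOf v
  rimOf-succ (low a)  (low b)        eq = adjacentᵇ-intro (sym eq)
  rimOf-succ (low a)  (high 0F)      eq = sym (trans (sym (+-identityʳ k)) eq)
  rimOf-succ (low a)  (high (suc j)) eq = ⊥-elim (m+1+n≰m k (subst (_≤ k) (sym eq) (toℕ<n a)))
  rimOf-succ (high i) (low b)        eq =
    ⊥-elim (m+n≮m k (suc (toℕ i)) (subst (_< k) (trans eq (sym (+-suc k (toℕ i)))) (toℕ<n b)))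
  rimOf-succ (high i) (high j)       eq =
    adjacentᵇ-intro (+-cancelˡ-≡ k _ _ (trans (+-suc k (toℕ i)) (sym eq)))

  rimOf-close : ∀ {c d} (u : RimView c) (v : RimView d) → position u ≡ k + 3 → position v ≡ 0 →
                rimOf u — rimOf v
  rimOf-close (low a)  _        eq _   = ⊥-elim (m+n≮m k 3 (subst (_< k) eq (toℕ<n a)))
  rimOf-close (high i) (high j) _  eq' = ⊥-elim (1+n≢0 eq')
  rimOf-close (high i) (low b)  eq eq'
    with refl ← toℕ-injective {i = i} {j = 3F} (+-cancelˡ-≡ k _ _ eq) = eq'

  rim-succ : ∀ c d → toℕ d ≡ suc (toℕ c) → rim c — rim d
  rim-succ c d eq = subst₂ _—_ (sym (rim-rimOf vc)) (sym (rim-rimOf vd))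
    (rimOf-succ vc vd (trans (sym (toℕ-position vd)) (trans eq (cong suc (toℕ-position vc)))))
    where vc = rimView c
          vd = rimView d

  rim-close : ∀ c d → toℕ c ≡ k + 3 → toℕ d ≡ 0 → rim c — rim d
  rim-close c d eqc eqd = subst₂ _—_ (sym (rim-rimOf vc)) (sym (rim-rimOf vd))
    (rimOf-close vc vd (trans (sym (toℕ-position vc)) eqc) (trans (sym (toℕ-position vd)) eqd))
    where vc = rimView c
          vd = rimView d

  rim-onRim : ∀ c → OnRim (rim c)
  rim-onRim c = subst OnRim (sym (rim-rimOf (rimView c))) (onRim-rimOf (rimView c))

  vertexᴹ : MVtx k → Vertex
  vertexᴹ x     = X
  vertexᴹ (w c) = ⟨ rim c ⟩
  vertexᴹ (v i) = ⟨ V i ⟩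

  mvtx : Vertex → MVtx k
  mvtx X       = x
  mvtx ⟨ L a ⟩ = w (a ↑ˡ 4)
  mvtx ⟨ H j ⟩ = w (k ↑ʳ j)
  mvtx ⟨ V i ⟩ = v i

  vertexᴹ∘toMVtx : ∀ p → vertexᴹ (toMVtx k p) ≡ vertex p
  vertexᴹ∘toMVtx zero = refl
  vertexᴹ∘toMVtx (suc p) with splitAt (k + 4) p
  ... | inj₁ _ = refl
  ... | inj₂ _ = refl

  toMVtx∘index : ∀ A → toMVtx k (index A) ≡ mvtx A
  toMVtx∘index X       = refl
  toMVtx∘index ⟨ L a ⟩ rewrite splitAt-↑ˡ (k + 4) (a ↑ˡ 4) k = refl
  toMVtx∘index ⟨ H j ⟩ rewrite splitAt-↑ˡ (k + 4) (k ↑ʳ j) k = refl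
  toMVtx∘index ⟨ V i ⟩ rewrite splitAt-↑ʳ (k + 4) k i = refl

  medge⇒∼ : ∀ {m m'} → MEdge k m m' → vertexᴹ m ∼ vertexᴹ m'
  medge⇒∼ (cyc c d eq)        = rim-succ c d eq
  medge⇒∼ (close c d eqc eqd) = rim-close c d eqc eqd
  medge⇒∼ (spoke c)           = rim-onRim c
  medge⇒∼ (clq i j i<j)       = <⇒≢ i<j ∘ cong toℕ
  medge⇒∼ (match i)           = subst (V i —_) (sym (rim-rimOf (low i))) refl

  Edge : MVtx k → MVtx k → Set
  Edge m m' = MEdge k m m' ⊎ MEdge k m' m

  swap : ∀ {m m'} → Edge m m' → Edge m' m
  swap = [ inj₂ , inj₁ ]′

  low-succ : ∀ {a b : Fin k} → suc (toℕ a) ≡ toℕ b → MEdge k (w (a ↑ˡ 4)) (w (b ↑ˡ 4))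
  low-succ {a} {b} eq = cyc _ _ (trans (toℕ-↑ˡ b 4) (trans (sym eq) (cong suc (sym (toℕ-↑ˡ a 4)))))

  high-succ : ∀ {i j : Fin 4} → suc (toℕ i) ≡ toℕ j → MEdge k (w (k ↑ʳ i)) (w (k ↑ʳ j))
  high-succ {i} {j} eq = cyc _ _ (trans (toℕ-↑ʳ k j)
    (trans (cong (k +_) (sym eq)) (trans (+-suc k (toℕ i)) (cong suc (sym (toℕ-↑ʳ k i))))))

  LH⇒edge : ∀ a j → LH a j → Edge (w (a ↑ˡ 4)) (w (k ↑ʳ j))
  LH⇒edge a 0F eq = inj₁ (cyc _ _ (trans (toℕ-↑ʳ k 0F)
    (trans (+-identityʳ k) (trans (sym eq) (cong suc (sym (toℕ-↑ˡ a 4)))))))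
  LH⇒edge a 3F eq = inj₂ (close _ _ (toℕ-↑ʳ k 3F) (trans (toℕ-↑ˡ a 4) eq))

  —⇒edge : ∀ {a b} → a — b → Edge (mvtx ⟨ a ⟩) (mvtx ⟨ b ⟩)
  —⇒edge {L a} {L b} adj = ⊎-map low-succ low-succ (adjacentᵇ-elim adj)
  —⇒edge {H i} {H j} adj = ⊎-map high-succ high-succ (adjacentᵇ-elim adj)
  —⇒edge {L a} {H j}     = LH⇒edge a j
  —⇒edge {H j} {L a}     = swap ∘ LH⇒edge a j
  —⇒edge {V i} {V j} i≢j with <-cmp i j
  ... | tri< i<j _   _   = inj₁ (clq i j i<j)
  ... | tri≈ _   i≡j _   = ⊥-elim (i≢j i≡j)
  ... | tri> _   _   j<i = inj₂ (clq j i j<i)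
  —⇒edge {V i} {L .i} refl = inj₁ (match i)
  —⇒edge {L j} {V .j} refl = inj₂ (match j)

  ∼⇒edge : ∀ {A B} → A ∼ B → Edge (mvtx A) (mvtx B)
  ∼⇒edge {X}       {⟨ L _ ⟩} _ = inj₁ (spoke _)
  ∼⇒edge {X}       {⟨ H _ ⟩} _ = inj₁ (spoke _)
  ∼⇒edge {⟨ L _ ⟩} {X}       _ = inj₂ (spoke _)
  ∼⇒edge {⟨ H _ ⟩} {X}       _ = inj₂ (spoke _)
  ∼⇒edge {⟨ a ⟩}   {⟨ b ⟩}     = —⇒edge {a} {b}

  adj⇒∼ : ∀ {p q} → Adj (M k) p q → vertex p ∼ vertex q
  adj⇒∼ {p} {q} = subst₂ _∼_ (vertexᴹ∘toMVtx p) (vertexᴹ∘toMVtx q) ∘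
    [ medge⇒∼ , ∼-sym {vertexᴹ (toMVtx k q)} ∘ medge⇒∼ ]′

  M-iso : GraphIso (M k) _∼_
  M-iso = record
    { decode        = vertex
    ; encode        = index
    ; decode∘encode = vertex∘index
    ; encode∘decode = index∘vertex
    ; adj⇒rel       = λ {p} {q} → adj⇒∼ {p} {q}
    ; rel⇒adj       = λ {A} {B} → subst₂ Edge (sym (toMVtx∘index A)) (sym (toMVtx∘index B)) ∘ ∼⇒edge
    }

  M⁻-iso : GraphIso (M k -ᵥ xM k) _—_
  M⁻-iso = record
    { decode        = vertex⁻
    ; encode        = index⁻
    ; decode∘encode = vertex⁻∘index⁻
    ; encode∘decode = index⁻∘vertex⁻
    ; adj⇒rel       = λ {p} {q} → adj⇒∼ {suc p} {suc q}
    ; rel⇒adj       = λ {a} {b} → GraphIso.rel⇒adj M-iso {⟨ a ⟩} {⟨ b ⟩}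
    }

  last : Fin k
  last = fromℕ (3 + k₀)

  L-last—H0 : L last — H 0F
  L-last—H0 = cong suc (toℕ-fromℕ (3 + k₀))

  -- The lower bound for M_k

  optimal : Vertex → Bool
  optimal ⟨ V _ ⟩  = true
  optimal ⟨ H 1F ⟩ = true
  optimal ⟨ H 2F ⟩ = true
  optimal _        = false

  data InClique : Vertex → Set where
    clique : ∀ i → InClique ⟨ V i ⟩

  centre-or-clique : ∀ A → Near _∼_ 1 A X ⊎ InClique A
  centre-or-clique X       = inj₁ (near-≡ refl)
  centre-or-clique ⟨ L _ ⟩ = inj₁ (near-edge tt)
  centre-or-clique ⟨ H _ ⟩ = inj₁ (near-edge tt)
  centre-or-clique ⟨ V i ⟩ = inj₂ (clique i)

  clique-near : ∀ i j → Near _∼_ 1 ⟨ V i ⟩ ⟨ V j ⟩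
  clique-near i j with i ≟ᶠ j
  ... | yes i≡j = near-≡ (cong (⟨_⟩ ∘ V) i≡j)
  ... | no  i≢j = near-edge i≢j

  via-centre : ∀ {A B} → Near _∼_ 1 A X → Near _∼_ 1 B X → Near _∼_ 2 A B
  via-centre A⋯X B⋯X = near-trans A⋯X (near-sym (λ {A} {B} → ∼-sym {A} {B}) B⋯X)

  diameter≤3 : ∀ A B → Near _∼_ 3 A B
  diameter≤3 A B with centre-or-clique A | centre-or-clique B
  ... | inj₁ A⋯X        | inj₁ B⋯X        = near-weaken (n≤1+n 2) (via-centre A⋯X B⋯X)
  ... | inj₂ (clique i) | inj₂ (clique j) = near-weaken (s≤s z≤n) (clique-near i j)
  ... | inj₂ (clique i) | inj₁ B⋯X        =
    near-trans (near-edge refl) (via-centre {⟨ L i ⟩} (near-edge tt) B⋯X)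
  ... | inj₁ A⋯X        | inj₂ (clique j) =
    near-trans (via-centre {B = ⟨ L j ⟩} A⋯X (near-edge tt)) (near-edge refl)

  LH-outside : ∀ {a j} → LH a j → optimal ⟨ H j ⟩ ≡ false
  LH-outside {j = 0F} _ = refl
  LH-outside {j = 3F} _ = refl

  H—onRim : ∀ {j b} → H j — b → OnRim b
  H—onRim {b = L _} _ = tt
  H—onRim {b = H _} _ = tt

  H-neighbours : ∀ a j b → H a — H j → H j — H b → optimal ⟨ H j ⟩ ≡ true →
                 optimal ⟨ H a ⟩ ≡ optimal ⟨ H b ⟩ → a ≡ b
  H-neighbours = toWitness {a? = all? λ a → all? λ j → all? λ b →
    T? _ →-dec (T? _ →-dec ((optimal ⟨ H j ⟩ ≟ᵇ true) →-dec
      ((optimal ⟨ H a ⟩ ≟ᵇ optimal ⟨ H b ⟩) →-dec (a ≟ᶠ b))))} _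

  optimal-H-far-from-clique : ∀ {j C b} → optimal ⟨ H j ⟩ ≡ true → ⟨ H j ⟩ ∼ C → ¬ C ∼ ⟨ V b ⟩
  optimal-H-far-from-clique {C = ⟨ L _ ⟩} H∈ e _ with () ← trans (sym H∈) (LH-outside e)

  clique-neighbours : ∀ {i A B} → ⟨ V i ⟩ ∼ A → ⟨ V i ⟩ ∼ B → optimal A ≡ optimal B →
                      Near _∼_ 1 A B
  clique-neighbours {A = ⟨ V a ⟩} {⟨ V b ⟩} _    _    _ = clique-near a b
  clique-neighbours {A = ⟨ L _ ⟩} {⟨ L _ ⟩} refl refl _ = near-≡ refl

  H-neighbours-near : ∀ {j A B} → A ∼ ⟨ H j ⟩ → ⟨ H j ⟩ ∼ B → optimal ⟨ H j ⟩ ≡ true →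
                      optimal A ≡ optimal B → Near _∼_ 1 A B
  H-neighbours-near {A = X}     {X}     _ _  _ _ = near-≡ refl
  H-neighbours-near {A = X}     {⟨ b ⟩} _ e' _ _ = near-edge (H—onRim {b = b} e')
  H-neighbours-near {A = ⟨ a ⟩} {X}     e _  _ _ = near-edge (H—onRim {b = a} (—-sym {a} e))
  H-neighbours-near {j} {⟨ H a ⟩} {⟨ H b ⟩} e e' H∈ same =
    near-≡ (cong (⟨_⟩ ∘ H) (H-neighbours a j b e e' H∈ same))
  H-neighbours-near {A = ⟨ L _ ⟩} e _  H∈ _ with () ← trans (sym H∈) (LH-outside e)
  H-neighbours-near {B = ⟨ L _ ⟩} _ e' H∈ _ with () ← trans (sym H∈) (LH-outside e')

  optimal-geodesic₂ : ∀ {A Y B} → A ∼ Y → Y ∼ B → optimal Y ≡ true → optimal A ≡ optimal B →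
                      Near _∼_ 1 A B
  optimal-geodesic₂ {A} {⟨ V _ ⟩} e e' _  same = clique-neighbours (∼-sym {A} e) e' same
  optimal-geodesic₂ {Y = ⟨ H _ ⟩} e e' H∈ same = H-neighbours-near e e' H∈ same
  optimal-geodesic₂ {Y = X}       _ _  ()
  optimal-geodesic₂ {Y = ⟨ L _ ⟩} _ _  ()

  optimal-geodesic₃ : ∀ {A Y Y' B} → A ∼ Y → Y ∼ Y' → Y' ∼ B → optimal Y ≡ true →
                      optimal A ≡ optimal B → Near _∼_ 2 A B
  optimal-geodesic₃ {⟨ V a ⟩} {⟨ V _ ⟩} {_} {⟨ V b ⟩} _ _ _ _ _ =
    near-weaken (s≤s z≤n) (clique-near a b)
  optimal-geodesic₃ {⟨ V _ ⟩} {⟨ V _ ⟩} {Y'} {⟨ H _ ⟩} _ e' e'' _ same =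
    ⊥-elim (optimal-H-far-from-clique {C = Y'} (sym same) (∼-sym {Y'} e'') (∼-sym {_} {Y'} e'))
  optimal-geodesic₃ {⟨ L _ ⟩} {⟨ V _ ⟩} {_} {B} _ _ _ _ same with centre-or-clique B
  ... | inj₁ B⋯X = via-centre (near-edge tt) B⋯X
  optimal-geodesic₃ {⟨ L _ ⟩} {⟨ V _ ⟩} {_} {_} _ _ _ _ () | inj₂ (clique _)
  optimal-geodesic₃ {A} {⟨ H _ ⟩} {Y'} {B} e e' e'' H∈ _ with centre-or-clique A | centre-or-clique B
  ... | inj₁ A⋯X        | inj₁ B⋯X        = via-centre A⋯X B⋯X
  ... | inj₁ _          | inj₂ (clique _) = ⊥-elim (optimal-H-far-from-clique {C = Y'} H∈ e' e'')
  ... | inj₂ (clique _) | _               = ⊥-elim e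

  optimal-set : Subset (suc ((k + 4) + k))
  optimal-set = tabulate (optimal ∘ vertex)

  optimal-set-dualGP : DualGP (M k) optimal-set
  optimal-set-dualGP = dualGPᵣ⇒dualGP M-iso (dualGPᵣ-cong (sym ∘ status-tabulate M-iso optimal)
    (dualGPᵣ-of-diameter≤3 (λ {A} {B} → ∼-sym {A} {B}) diameter≤3 optimal-geodesic₂ optimal-geodesic₃))

  ∣∣-by-kind : ∀ Z → status M-iso Z X ≡ false →
    ∣ Z ∣ ≡ (∣ tabulate (λ a → status M-iso Z ⟨ L a ⟩) ∣ + ∣ tabulate (λ j → status M-iso Z ⟨ H j ⟩) ∣) +
            ∣ tabulate (λ i → status M-iso Z ⟨ V i ⟩) ∣
  ∣∣-by-kind Z x∉Z = begin
    ∣ Z ∣                                             ≡⟨ cong ∣_∣ (sym (tabulate∘lookup Z)) ⟩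
    ∣ lookup Z zero ∷ tabulate (lookup Z ∘ suc) ∣      ≡⟨ cong (λ b → ∣ b ∷ tabulate (lookup Z ∘ suc) ∣) x∉Z ⟩
    ∣ tabulate (lookup Z ∘ suc) ∣                      ≡⟨ ∣tabulate∣-splitAt (k + 4) (lookup Z ∘ suc) ⟩
    ∣ tabulate (λ c → lookup Z (suc (c ↑ˡ k))) ∣ + ∣Vs∣
      ≡⟨ cong (_+ ∣Vs∣) (∣tabulate∣-splitAt k (λ c → lookup Z (suc (c ↑ˡ k)))) ⟩
    (∣ tabulate (λ a → status M-iso Z ⟨ L a ⟩) ∣ + ∣ tabulate (λ j → status M-iso Z ⟨ H j ⟩) ∣) + ∣Vs∣ ∎
    where
    open ≡-Reasoning
    ∣Vs∣ = ∣ tabulate (λ i → status M-iso Z ⟨ V i ⟩) ∣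

  ∣optimal-set∣ : ∣ optimal-set ∣ ≡ k + 2
  ∣optimal-set∣ = begin
    ∣ optimal-set ∣ ≡⟨ ∣∣-by-kind optimal-set (optimal-status X) ⟩
    (∣ tabulate (λ a → status M-iso optimal-set ⟨ L a ⟩) ∣ +
     ∣ tabulate (λ j → status M-iso optimal-set ⟨ H j ⟩) ∣) +
     ∣ tabulate (λ i → status M-iso optimal-set ⟨ V i ⟩) ∣
                    ≡⟨ cong₂ _+_ (cong₂ _+_ (∣tabulate∣≡0 (optimal-status ∘ ⟨_⟩ ∘ L))
                                            (cong ∣_∣ (tabulate-cong (optimal-status ∘ ⟨_⟩ ∘ H))))
                                 (∣tabulate∣≡n (optimal-status ∘ ⟨_⟩ ∘ V)) ⟩
    (0 + 2) + k     ≡⟨ +-comm 2 k ⟩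
    k + 2           ∎
    where
    open ≡-Reasoning
    optimal-status = status-tabulate M-iso optimal

  -- The upper bound for M_k

  module _ {Z : Subset (suc ((k + 4) + k))} (dgp : DualGP (M k) Z) where
    private
      z : Vertex → Bool
      z = status M-iso Z

      dgpᵣ : DualGPᵣ _∼_ z
      dgpᵣ = dualGP⇒dualGPᵣ M-iso dgp

    centre-out : z X ≡ false
    centre-out = induced-claw-centre dgpᵣ (λ {A} {B} → ∼-sym {A} {B}) record
      { A = ⟨ L 0F ⟩ ; B = ⟨ L 2F ⟩ ; C = ⟨ H 1F ⟩
      ; Y—A = tt ; Y—B = tt ; Y—C = tt
      ; A⋯B = far₂ (λ ()) (λ ()) ; A⋯C = far₂ (λ ()) (λ ()) ; B⋯C = far₂ (λ ()) (λ ()) }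

    matched-in : ∀ a → z ⟨ L a ⟩ ≡ true → z ⟨ V a ⟩ ≡ true
    matched-in a La∈ =
      split₂-forces (geodesic₂-split dgpᵣ X ⟨ L a ⟩ ⟨ V a ⟩ (far₂ (λ ()) (λ ())) tt refl) La∈ centre-out

    matched-unique : ∀ a → z ⟨ L a ⟩ ≡ true → ∀ b → z ⟨ V b ⟩ ≡ true → b ≡ a
    matched-unique a La∈ b Vb∈ with b ≟ᶠ a
    ... | yes b≡a = b≡a
    ... | no  b≢a = ⊥-elim (geodesic₂-split dgpᵣ ⟨ L a ⟩ ⟨ V a ⟩ ⟨ V b ⟩ (far₂ (λ ()) b≢a)
                              refl (≢-sym b≢a) (matched-in a La∈) (trans La∈ (sym Vb∈)))

    H-pattern : (∀ a → z ⟨ L a ⟩ ≡ false) → Inner₄ (z ⟨ H 0F ⟩) (z ⟨ H 1F ⟩) (z ⟨ H 2F ⟩) (z ⟨ H 3F ⟩)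
    H-pattern L-out = inner₄ _ _ _ _ (L-out last) (L-out 0F)
      (geodesic₂-split dgpᵣ ⟨ L last ⟩ ⟨ H 0F ⟩ ⟨ H 1F ⟩ (far₂ (λ ()) (λ ())) L-last—H0 tt)
      (geodesic₂-split dgpᵣ ⟨ H 0F ⟩ ⟨ H 1F ⟩ ⟨ H 2F ⟩ (far₂ (λ ()) (λ ())) tt tt)
      (geodesic₂-split dgpᵣ ⟨ H 1F ⟩ ⟨ H 2F ⟩ ⟨ H 3F ⟩ (far₂ (λ ()) (λ ())) tt tt)
      (geodesic₂-split dgpᵣ ⟨ H 2F ⟩ ⟨ H 3F ⟩ ⟨ L 0F ⟩ (far₂ (λ ()) (λ ())) tt refl)

    dualGP⇒∣∣≤k+2 : ∣ Z ∣ ≤ k + 2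
    dualGP⇒∣∣≤k+2 rewrite ∣∣-by-kind Z centre-out with any? (λ a → z ⟨ L a ⟩ ≟ᵇ true)
    ... | yes (a , La∈) = ≤-trans
      (+-mono-≤ (+-mono-≤ (∣tabulate∣≤1 a (λ b Lb∈ → matched-unique a La∈ b (matched-in b Lb∈)))
                          (∣p∣≤n (tabulate (λ j → z ⟨ H j ⟩))))
                (∣tabulate∣≤1 {f = λ i → z ⟨ V i ⟩} a (matched-unique a La∈)))
      (s≤s (s≤s (s≤s (s≤s (m≤n+m 2 k₀)))))
    ... | no ¬L∈ = ≤-trans
      (+-mono-≤ (+-mono-≤ (≤-reflexive (∣tabulate∣≡0 L-out)) (∣Inner₄∣≤2 (H-pattern L-out)))
                (∣p∣≤n (tabulate (λ i → z ⟨ V i ⟩))))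
      (≤-reflexive (+-comm 2 k))
      where
      L-out : ∀ a → z ⟨ L a ⟩ ≡ false
      L-out a = ¬-not (λ La∈ → ¬L∈ (a , La∈))

  -- M_k − x

  L-far : ∀ {a b : Fin k} → toℕ b ≡ 2 + toℕ a → Far _—_ 2 (L a) (L b)
  L-far {a} {b} b≡2+a = far₂ (λ { refl → m≢1+n+m (toℕ a) b≡2+a }) λ a—b →
    [ (λ e → 1+n≢n (sym (trans e b≡2+a)))
    , (λ e → m≢1+n+m (toℕ a) (sym (trans (cong suc (sym b≡2+a)) e))) ]′ (adjacentᵇ-elim a—b)

  L—inject₁ : ∀ j → L (suc j) — L (inject₁ j)
  L—inject₁ j = adjacentᵇ-sym {toℕ (inject₁ j)} (adjacentᵇ-intro (cong suc (toℕ-inject₁ j)))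

  inject₁-far-V : ∀ j → Far _—_ 2 (L (inject₁ j)) (V (suc j))
  inject₁-far-V j = far₂ (λ ()) (λ e → 1+n≢n (trans (cong toℕ e) (toℕ-inject₁ j)))

  L-claw : ∀ i → InducedClaw _—_ (L i)
  L-claw 0F = record
    { A = H 3F ; B = L 1F ; C = V 0F ; Y—A = refl ; Y—B = tt ; Y—C = refl
    ; A⋯B = far₂ (λ ()) (λ ()) ; A⋯C = far₂ (λ ()) (λ ()) ; B⋯C = far₂ (λ ()) (λ ()) }
  L-claw (suc j) with suc (suc (toℕ j)) ≟ k
  ... | yes j+2≡k = record
    { A = L (inject₁ j) ; B = H 0F ; C = V (suc j)
    ; Y—A = L—inject₁ j ; Y—B = j+2≡k ; Y—C = refl
    ; A⋯B = far₂ (λ ()) (λ e → 1+n≢n (trans j+2≡k (sym (trans (cong suc (sym (toℕ-inject₁ j))) e))))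
    ; A⋯C = inject₁-far-V j ; B⋯C = far₂ (λ ()) (λ ()) }
  ... | no j+2≢k = record
    { A = L (inject₁ j) ; B = L b ; C = V (suc j)
    ; Y—A = L—inject₁ j ; Y—B = adjacentᵇ-intro (sym b≡j+2) ; Y—C = refl
    ; A⋯B = L-far (trans b≡j+2 (cong (2 +_) (sym (toℕ-inject₁ j))))
    ; A⋯C = inject₁-far-V j
    ; B⋯C = far₂ (λ ()) (λ e → 1+n≢n (sym (trans (cong toℕ e) b≡j+2))) }
    where
    j+2<k = ≤∧≢⇒< (toℕ<n (suc j)) j+2≢k
    b     = fromℕ< j+2<k
    b≡j+2 = toℕ-fromℕ< j+2<k

  far-L0-L3 : Far _—_ 3 (L 0F) (L 3F)
  far-L0-L3 = far₃ (λ ()) (λ ()) λ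
    { {L 0F}            ()
    ; {L 1F}            _ ()
    ; {L (suc (suc _))} ()
    ; {H 0F}            ()
    ; {H 3F}            _ ()
    ; {V _}             refl ()
    }

  far-Llast-H2 : Far _—_ 3 (L last) (H 2F)
  far-Llast-H2 = far₃ (λ ()) (λ ()) λ
    { {H 0F} _ ()
    ; {H 3F} () _
    }

  far-H0-H3 : Far _—_ 3 (H 0F) (H 3F)
  far-H0-H3 = far₃ (λ ()) (λ ()) λ
    { {L 0F}      () _
    ; {L (suc _)} _ ()
    ; {H 0F}      ()
    ; {H 1F}      _ ()
    ; {H 2F}      ()
    ; {H 3F}      ()
    }

  far-H1-L0 : Far _—_ 3 (H 1F) (L 0F)
  far-H1-L0 = far₃ (λ ()) (λ ()) λ
    { {H 0F} _ ()
    ; {H 1F} ()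
    ; {H 2F} _ ()
    ; {H 3F} ()
    }

  module _ {Z : Subset ((k + 4) + k)} (dgp : DualGP (M k -ᵥ xM k) Z) where
    private
      z : Vertex⁻ → Bool
      z = status M⁻-iso Z

      dgpᵣ : DualGPᵣ _—_ z
      dgpᵣ = dualGP⇒dualGPᵣ M⁻-iso dgp

    L-out : ∀ a → z (L a) ≡ false
    L-out a = induced-claw-centre dgpᵣ (λ {a} {b} → —-sym {a} {b}) (L-claw a)

    V-out : ∀ i → z (V i) ≡ false
    V-out i = ¬-not λ Vi∈ → geodesic₃-split dgpᵣ (L 0F) (V 0F) (V 3F) (L 3F) far-L0-L3 refl (λ ()) refl
      (inj₁ (V0∈ Vi∈)) (trans (L-out 0F) (sym (L-out 3F)))
      where
      V0∈ : z (V i) ≡ true → z (V 0F) ≡ true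
      V0∈ Vi∈ with i ≟ᶠ 0F
      ... | yes refl = Vi∈
      ... | no  i≢0  = split₂-forces
        (geodesic₂-split dgpᵣ (L i) (V i) (V 0F) (far₂ (λ ()) (i≢0 ∘ sym)) refl i≢0) Vi∈ (L-out i)

    H-out : ∀ j → z (H j) ≡ false
    H-out j = pick j (Inner₄-empty (L-out last) (L-out 0F)
      (inner₄ _ _ _ _ (L-out last) (L-out 0F)
        (geodesic₂-split dgpᵣ (L last) (H 0F) (H 1F) (far₂ (λ ()) (λ ())) L-last—H0 tt)
        (geodesic₂-split dgpᵣ (H 0F) (H 1F) (H 2F) (far₂ (λ ()) (λ ())) tt tt)
        (geodesic₂-split dgpᵣ (H 1F) (H 2F) (H 3F) (far₂ (λ ()) (λ ())) tt tt)
        (geodesic₂-split dgpᵣ (H 2F) (H 3F) (L 0F) (far₂ (λ ()) (λ ())) tt refl))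
      (geodesic₃-split dgpᵣ (L last) (H 0F) (H 1F) (H 2F) far-Llast-H2 L-last—H0 tt tt)
      (geodesic₃-split dgpᵣ (H 0F) (H 1F) (H 2F) (H 3F) far-H0-H3 tt tt tt)
      (geodesic₃-split dgpᵣ (H 1F) (H 2F) (H 3F) (L 0F) far-H1-L0 tt tt refl))
      where
      pick : ∀ j → z (H 0F) ≡ false × z (H 1F) ≡ false × z (H 2F) ≡ false × z (H 3F) ≡ false →
             z (H j) ≡ false
      pick 0F (h₀ , _ , _ , _) = h₀
      pick 1F (_ , h₁ , _ , _) = h₁
      pick 2F (_ , _ , h₂ , _) = h₂
      pick 3F (_ , _ , _ , h₃) = h₃

    dualGP⁻⇒∣∣≡0 : ∣ Z ∣ ≡ 0
    dualGP⁻⇒∣∣≡0 = status-false⇒∣∣≡0 M⁻-iso {Z} all-out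
      where
      all-out : ∀ a → z a ≡ false
      all-out (L a) = L-out a
      all-out (H j) = H-out j
      all-out (V i) = V-out i

proposition3p6 : (k : ℕ) → 4 ≤ k →
    GpdIs (M k) (k + 2) × GpdIs (M k -ᵥ xM k) 0
proposition3p6 _ 4≤k with m≤n⇒∃[o]m+o≡n 4≤k
... | k₀ , refl =
  ((optimal-set , optimal-set-dualGP , ∣optimal-set∣) , λ _ → dualGP⇒∣∣≤k+2) ,
  ((∅ , dualGP-∅ , ∣⊥∣≡0 ((k + 4) + k)) , λ _ → ≤-reflexive ∘ dualGP⁻⇒∣∣≡0)
  where open Mₖ k₀
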